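{- Let $G=(A,B,E)$ be a bipartite graph with a proper edge coloring $\chi:E\to\{1,\dots,d\}$, $d\ge2$. Then the output $G'=(A,B,E')$ of lexicographic thinning (for every outcome of the random choices), with colors inherited from $\chi$, contains no slow walk.
   Context: A bipartite graph is a triple $G=(A,B,E)$ with disjoint $A,B$ and $E\subseteq A\times B$, edges written $(x,y)$ with $x\in A$, $y\in B$. A walk of length $m$ is $v_0,\dots,v_m$ with consecutive vertices adjacent and $v_{i-2}\ne v_i$; its coloring is the sequence of colors of its edges. A slow walk is a walk of length 4 with $v_0\in B$ whose coloring $(c_1,c_2,c_3,c_4)$ satisfies $c_2<c_3<c_4$ and $c_2<c_1\le c_4$. For distinct $a,b\in\{0,1\}^t$, $P(a,b)$ is the first position where they differ; $\{0,1\}^t$ is ordered lexicographically. Lexicographic thinning: let $t=\lceil(\log_2 d)/2\rceil+1$ and $H$ the set of triples $(a,i,z)$ with $a\in\{0,1\}^t$, $i\in\{2,\dots,t\}$, $z\in\{1,\dots,2^i\}$, $a$ having $0$ in position $i$, ordered by $(a,i,z)<(b,j,s)$ iff $a<b$, or $a=b$ and $i<j$, or $(a,i)=(b,j)$ and $z<s$. A random $F:\{1,\dots,d\}\to H$ is chosen with $F(1)$ uniform among elements whose $a$ has first bit $0$ and $F(k)$ the successor of $F(k-1)$ in $H$. An edge $e$ with $F(\chi(e))=(a,i,z)$ has class $a$ and type $i$. Independent uniform $a_x\in\{0,1\}^t$ are chosen for all vertices. An edge $(x,y)$ of class $a$ and type $i$ is eligible if $a=a_y<a_x$ and $P(a,a_x)=i$.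 $E'$ consists of the eligible edges not adjacent to another eligible edge of the same type. -}

module Defs where

open import Data.Nat using (ℕ; zero; suc; _+_; _^_; _≤_; _<_; ⌈_/2⌉)
open import Data.Nat.Logarithm using (⌈log₂_⌉)
open import Data.Bool using (Bool; true; false)
open import Data.Vec using (Vec; []; _∷_)
open import Data.Fin using (Fin)
open import Data.Product using (Σ; _×_; ∃-syntax)
open import Data.Sum using (_⊎_)
open import Relation.Nullary using (¬_)
open import Relation.Binary.PropositionalEquality using (_≡_; _≢_)

-- t = ⌈(log₂ d)/2⌉ + 1 ; note ⌈x/2⌉ = ⌈⌈x⌉/2⌉ for real x
tOf : ℕ → ℕ
tOf d = ⌈ ⌈log₂ d ⌉ /2⌉ + 1

-- bit at (1-indexed) position; out-of-range positions are never used
bitAt : ∀ {n} → Vec Bool n → ℕ → Bool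
bitAt []       _             = true
bitAt (x ∷ xs) zero          = true
bitAt (x ∷ xs) (suc zero)    = x
bitAt (x ∷ xs) (suc (suc k)) = bitAt xs (suc k)

-- lexicographic order on {0,1}^n (false = 0 < true = 1)
data _<lex_ : ∀ {n} → Vec Bool n → Vec Bool n → Set where
  here  : ∀ {n} {xs ys : Vec Bool n} → (false ∷ xs) <lex (true ∷ ys)
  there : ∀ {n} {x} {xs ys : Vec Bool n} → xs <lex ys → (x ∷ xs) <lex (x ∷ ys)

-- P(a,b) = i : i is the first (1-indexed) position where a and b differ
data FirstDiff : ∀ {n} → Vec Bool n → Vec Bool n → ℕ → Set where
  here  : ∀ {n} {x y} {xs ys : Vec Bool n} → x ≢ y → FirstDiff (x ∷ xs) (y ∷ ys) 1
  there : ∀ {n} {x} {xs ys : Vec Bool n} {k} → FirstDiff xs ys k → FirstDiff (x ∷ xs) (x ∷ ys) (suc k)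

record HElt (t : ℕ) : Set where
  constructor mkH
  field
    a    : Vec Bool t
    i    : ℕ
    z    : ℕ
    2≤i  : 2 ≤ i
    i≤t  : i ≤ t
    1≤z  : 1 ≤ z
    z≤2^i : z ≤ 2 ^ i
    ai≡0 : bitAt a i ≡ false
open HElt public

_<H_ : ∀ {t} → HElt t → HElt t → Set
h <H h' = (a h <lex a h')
        ⊎ ((a h ≡ a h' × i h < i h')
        ⊎ (a h ≡ a h' × i h ≡ i h' × z h < z h'))

IsSucc : ∀ {t} → HElt t → HElt t → Set
IsSucc {t} h h' = h <H h' × ((g : HElt t) → ¬ (h <H g × g <H h'))

-- a possible outcome of the random choice of F : {1..d} → H
ValidF : (d : ℕ) → (ℕ → HElt (tOf d)) → Set
ValidF d F = (bitAt (a (F 1)) 1 ≡ false)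
           × ((k : ℕ) → 1 ≤ k → suc k ≤ d → IsSucc (F k) (F (suc k)))

-- finite bipartite graph: A = Fin na, B = Fin nb, (x,y) ∈ E iff E x y ≡ true.
-- a coloring is given as χ : A → B → ℕ, only its values on edges matter.
ProperColoring : ∀ {na nb} → (Fin na → Fin nb → Bool) → ℕ → (Fin na → Fin nb → ℕ) → Set
ProperColoring {na} {nb} E d χ =
    ((x : Fin na) (y : Fin nb) → E x y ≡ true → 1 ≤ χ x y × χ x y ≤ d)
  × ((x : Fin na) (y y' : Fin nb) → E x y ≡ true → E x y' ≡ true → y ≢ y' → χ x y ≢ χ x y')
  × ((x x' : Fin na) (y : Fin nb) → E x y ≡ true → E x' y ≡ true → x ≢ x' → χ x y ≢ χ x' y)

module Thinning {na nb : ℕ} (d : ℕ)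
  (E : Fin na → Fin nb → Bool) (χ : Fin na → Fin nb → ℕ)
  (F : ℕ → HElt (tOf d))
  (ax : Fin na → Vec Bool (tOf d)) (ay : Fin nb → Vec Bool (tOf d)) where

  cls : Fin na → Fin nb → Vec Bool (tOf d)
  cls x y = a (F (χ x y))

  typ : Fin na → Fin nb → ℕ
  typ x y = i (F (χ x y))

  Eligible : Fin na → Fin nb → Set
  Eligible x y = E x y ≡ true × cls x y ≡ ay y × ay y <lex ax x
               × FirstDiff (cls x y) (ax x) (typ x y)

  Adjacent : Fin na → Fin nb → Fin na → Fin nb → Set
  Adjacent x y x' y' = (x ≡ x' × y ≢ y') ⊎ (y ≡ y' × x ≢ x')

  E' : Fin na → Fin nb → Set
  E' x y = Eligible x y
         × ((x' : Fin na) (y' : Fin nb) → Eligible x' y' → Adjacent x y x' y' → typ x' y' ≢ typ x y)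

SlowWalk : ∀ {na nb} → (Fin na → Fin nb → Set) → (Fin na → Fin nb → ℕ) → Set
SlowWalk {na} {nb} E'' χ =
  Σ (Fin nb) λ v0 → Σ (Fin na) λ v1 → Σ (Fin nb) λ v2 → Σ (Fin na) λ v3 → Σ (Fin nb) λ v4 →
    (E'' v1 v0 × E'' v1 v2 × E'' v3 v2 × E'' v3 v4)
  × (v0 ≢ v2 × v1 ≢ v3 × v2 ≢ v4)
  × (χ v1 v2 < χ v3 v2 × χ v3 v2 < χ v3 v4
     × χ v1 v2 < χ v1 v0 × χ v1 v0 ≤ χ v3 v4)

module Submission where

-- A slow walk v0 v1 v2 v3 v4 consists of edges e1 = (v1,v0), e2 = (v1,v2),
-- e3 = (v3,v2), e4 = (v3,v4) of E' whose colours satisfy c2 < c3 < c4 and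
-- c2 < c1 ≤ c4.  Since F is strictly increasing on {1..d}, the labels
-- h_k = F c_k satisfy h2 < h3 < h4 and h2 < h1 ≤ h4 in H.  Write a_k, i_k for
-- the class and type of e_k.
--   * e2 and e3 share v2 ∈ B, so a2 = a3 = a_{v2}; their types differ (E'
--     forbids adjacent eligible edges of equal type), hence i2 < i3.
--   * e2 and e1 lie below the common vertex v1 ∈ A and have distinct types
--     P(a2, a_{v1}) ≠ P(a1, a_{v1}); together with a2 ≤ a1 this forces
--     a2 < a1 with first difference at i2.  Likewise a3 < a4, first
--     difference at i3.
--   * a4 agrees with a2 = a3 before position i3 > i2, while a1 jumps above a2 at i2,
--     so a4 < a1, contradicting h1 ≤ h4.

open import Defs
open import Data.Nat using (ℕ; suc; _≤_; _<_; s≤s)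
open import Data.Nat.Properties using (m≤n⇒m<n∨m≡n; ≤-trans; n≤1+n; <⇒≤; <-trans; ≤-reflexive; ≤∧≢⇒<)
open import Data.Bool using (Bool)
open import Data.Vec using (Vec)
open import Data.Fin using (Fin)
open import Data.Product using (_,_; proj₁; proj₂; _×_)
open import Data.Sum using (_⊎_; inj₁; inj₂)
open import Data.Empty using (⊥-elim)
open import Relation.Nullary using (¬_)
open import Relation.Binary.PropositionalEquality using (_≡_; _≢_; refl; sym; trans; cong; subst)

<lex-irrefl : ∀ {n} {u : Vec Bool n} → ¬ (u <lex u)
<lex-irrefl (there l) = <lex-irrefl l

<lex-trans : ∀ {n} {u v w : Vec Bool n} → u <lex v → v <lex w → u <lex w
<lex-trans here      (there _) = here
<lex-trans (there _) here      = here
<lex-trans (there l) (there m) = there (<lex-trans l m)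

firstDiff-unique : ∀ {n} {u v : Vec Bool n} {p q} → FirstDiff u v p → FirstDiff u v q → p ≡ q
firstDiff-unique (here _)  (here _)  = refl
firstDiff-unique (here x≢x) (there _) = ⊥-elim (x≢x refl)
firstDiff-unique (there _) (here x≢x) = ⊥-elim (x≢x refl)
firstDiff-unique (there f) (there g) = cong suc (firstDiff-unique f g)

distinctDiffs⇒<lex : ∀ {n} {u w X : Vec Bool n} {p q}
  → FirstDiff u X p → FirstDiff w X q → p ≢ q → u ≡ w ⊎ u <lex w → u <lex w
distinctDiffs⇒<lex fu fw p≢q (inj₁ refl) = ⊥-elim (p≢q (firstDiff-unique fu fw))
distinctDiffs⇒<lex _  _  _   (inj₂ u<w)  = u<w

-- If u < w both lie below X, leaving X at different positions p ≠ q, then u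
-- leaves X first (p < q), and at that position u drops below w: P(u,w) = p.
firstDiff-belowCommon : ∀ {n} {u w X : Vec Bool n} {p q}
  → u <lex X → FirstDiff u X p → w <lex X → FirstDiff w X q
  → u <lex w → p ≢ q → FirstDiff u w p
firstDiff-belowCommon here (here _) here (here _) _ p≢q = ⊥-elim (p≢q refl)
firstDiff-belowCommon here (here _) (there _) (here x≢x) _ _ = ⊥-elim (x≢x refl)
firstDiff-belowCommon here (here _) _ (there _) _ _ = here (λ ())
firstDiff-belowCommon (there _) (here x≢x) _ _ _ _ = ⊥-elim (x≢x refl)
firstDiff-belowCommon (there _) (there _) here _ () _
firstDiff-belowCommon (there _) (there _) (there _) (here x≢x) _ _ = ⊥-elim (x≢x refl)
firstDiff-belowCommon (there u<X) (there fu) (there w<X) (there fw) (there u<w) p≢q =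
  there (firstDiff-belowCommon u<X fu w<X fw u<w (λ p≡q → p≢q (cong suc p≡q)))

-- If u < w₀ with first difference at p, and w₄ agrees with u up to a later
-- position q > p, then w₄ < w₀: the comparison is decided at position p.
<lex-decidedEarlier : ∀ {n} {u w₀ w₄ : Vec Bool n} {p q}
  → FirstDiff u w₀ p → u <lex w₀ → FirstDiff u w₄ q → p < q → w₄ <lex w₀
<lex-decidedEarlier (here _)  here      (here _)  (s≤s ())
<lex-decidedEarlier (here _)  here      (there _) _ = here
<lex-decidedEarlier (here x≢x) (there _) _ _ = ⊥-elim (x≢x refl)
<lex-decidedEarlier (there _) (there _) (here _)  (s≤s ())
<lex-decidedEarlier (there f) (there l) (there g) (s≤s p<q) = there (<lex-decidedEarlier f l g p<q)

<H-trans : ∀ {t} {h g k : HElt t} → h <H g → g <H k → h <H k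
<H-trans (inj₁ l) (inj₁ m) = inj₁ (<lex-trans l m)
<H-trans {h = h} (inj₁ l) (inj₂ (inj₁ (e , _))) = inj₁ (subst (a h <lex_) e l)
<H-trans {h = h} (inj₁ l) (inj₂ (inj₂ (e , _))) = inj₁ (subst (a h <lex_) e l)
<H-trans {k = k} (inj₂ (inj₁ (e , _))) (inj₁ m) = inj₁ (subst (_<lex a k) (sym e) m)
<H-trans {k = k} (inj₂ (inj₂ (e , _))) (inj₁ m) = inj₁ (subst (_<lex a k) (sym e) m)
<H-trans (inj₂ (inj₁ (e , p))) (inj₂ (inj₁ (e' , q))) = inj₂ (inj₁ (trans e e' , <-trans p q))
<H-trans {h = h} (inj₂ (inj₁ (e , p))) (inj₂ (inj₂ (e' , q , _))) = inj₂ (inj₁ (trans e e' , subst (i h <_) q p))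
<H-trans {k = k} (inj₂ (inj₂ (e , p , _))) (inj₂ (inj₁ (e' , q))) = inj₂ (inj₁ (trans e e' , subst (_< i k) (sym p) q))
<H-trans (inj₂ (inj₂ (e , p , r))) (inj₂ (inj₂ (e' , q , s))) = inj₂ (inj₂ (trans e e' , trans p q , <-trans r s))

_≤H_ : ∀ {t} → HElt t → HElt t → Set
h ≤H g = h ≡ g ⊎ h <H g

<H⇒class≤ : ∀ {t} {h g : HElt t} → h <H g → a h ≡ a g ⊎ a h <lex a g
<H⇒class≤ (inj₁ l)              = inj₂ l
<H⇒class≤ (inj₂ (inj₁ (e , _))) = inj₁ e
<H⇒class≤ (inj₂ (inj₂ (e , _))) = inj₁ e

≤H⇒¬class> : ∀ {t} {h g : HElt t} → h ≤H g → ¬ (a g <lex a h)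
≤H⇒¬class> (inj₁ refl) l = <lex-irrefl l
≤H⇒¬class> {h = h} {g} (inj₂ h<g) l with <H⇒class≤ {h = h} {g} h<g
... | inj₁ e = <lex-irrefl (subst (a g <lex_) e l)
... | inj₂ m = <lex-irrefl (<lex-trans l m)

<H-sameClass⇒type≤ : ∀ {t} {h g : HElt t} → h <H g → a h ≡ a g → i h ≤ i g
<H-sameClass⇒type≤ {g = g} (inj₁ l) e = ⊥-elim (<lex-irrefl (subst (_<lex a g) e l))
<H-sameClass⇒type≤ (inj₂ (inj₁ (_ , p)))     _ = <⇒≤ p
<H-sameClass⇒type≤ (inj₂ (inj₂ (_ , p , _))) _ = ≤-reflexive p

F-strictMono : ∀ {d} (F : ℕ → HElt (tOf d)) → ValidF d F
  → ∀ {k k'} → 1 ≤ k → k < k' → k' ≤ d → F k <H F k'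
F-strictMono F validF@(_ , isSucc) {k} {suc j} 1≤k (s≤s k≤j) 1+j≤d
  with m≤n⇒m<n∨m≡n k≤j
... | inj₂ refl = proj₁ (isSucc k 1≤k 1+j≤d)
... | inj₁ k<j  = <H-trans {h = F k} {F j} {F (suc j)} (F-strictMono F validF 1≤k k<j (≤-trans (n≤1+n j) 1+j≤d))
                           (proj₁ (isSucc j (≤-trans 1≤k (<⇒≤ k<j)) 1+j≤d))

F-mono : ∀ {d} (F : ℕ → HElt (tOf d)) → ValidF d F
  → ∀ {k k'} → 1 ≤ k → k ≤ k' → k' ≤ d → F k ≤H F k'
F-mono F validF 1≤k k≤k' k'≤d with m≤n⇒m<n∨m≡n k≤k'
... | inj₁ k<k' = inj₂ (F-strictMono F validF 1≤k k<k' k'≤d)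
... | inj₂ refl = inj₁ refl

module EligibleEdges {na nb : ℕ} (d : ℕ)
  (E : Fin na → Fin nb → Bool) (χ : Fin na → Fin nb → ℕ)
  (F : ℕ → HElt (tOf d))
  (ax : Fin na → Vec Bool (tOf d)) (ay : Fin nb → Vec Bool (tOf d)) where

  open Thinning d E χ F ax ay

  sameB⇒sameClass : ∀ {x x' y} → Eligible x y → Eligible x' y → cls x y ≡ cls x' y
  sameB⇒sameClass (_ , cls≡ay , _) (_ , cls'≡ay , _) = trans cls≡ay (sym cls'≡ay)

  sameA⇒classStep : ∀ {x y y'} → Eligible x y → Eligible x y' → typ x y ≢ typ x y'
    → cls x y ≡ cls x y' ⊎ cls x y <lex cls x y'
    → cls x y <lex cls x y' × FirstDiff (cls x y) (cls x y') (typ x y)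
  sameA⇒classStep {x} {y} {y'} (_ , c≡ , c< , fd) (_ , c'≡ , c'< , fd') t≢t' c≤c' =
    c<c' , firstDiff-belowCommon (below c≡ c<) fd (below c'≡ c'<) fd' c<c' t≢t'
    where
    c<c' : cls x y <lex cls x y'
    c<c' = distinctDiffs⇒<lex fd fd' t≢t' c≤c'
    below : ∀ {c y} → c ≡ ay y → ay y <lex ax x → c <lex ax x
    below refl l = l

lemma4 : (na nb d : ℕ) → 2 ≤ d
       → (E : Fin na → Fin nb → Bool) (χ : Fin na → Fin nb → ℕ)
       → ProperColoring E d χ
       → (F : ℕ → HElt (tOf d)) → ValidF d F
       → (ax : Fin na → Vec Bool (tOf d)) (ay : Fin nb → Vec Bool (tOf d))
       → ¬ SlowWalk (Thinning.E' d E χ F ax ay) χ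
lemma4 na nb d _ E χ (inRange , _) F validF ax ay
  (v0 , v1 , v2 , v3 , v4 , ((el1 , ad1) , (el2 , _) , (el3 , ad3) , (el4 , ad4))
      , (v0≢v2 , v1≢v3 , v2≢v4) , (c2<c3 , c3<c4 , c2<c1 , c1≤c4))
  = ≤H⇒¬class> {h = F (χ v1 v0)} {F (χ v3 v4)} (F-mono F validF (low el1) c1≤c4 (high el4)) a4<a1
  where
  open Thinning d E χ F ax ay
  open EligibleEdges d E χ F ax ay
  -- colours of eligible edges lie in {1..d}, the range where F is monotone
  low  : ∀ {x y} → Eligible x y → 1 ≤ χ x y
  low  el = proj₁ (inRange _ _ (proj₁ el))
  high : ∀ {x y} → Eligible x y → χ x y ≤ d
  high el = proj₂ (inRange _ _ (proj₁ el))
  -- consecutive edges of the walk are adjacent in E', so their types differ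
  t2≢t1 : typ v1 v2 ≢ typ v1 v0
  t2≢t1 = ad1 v1 v2 el2 (inj₁ (refl , v0≢v2))
  t2≢t3 : typ v1 v2 ≢ typ v3 v2
  t2≢t3 = ad3 v1 v2 el2 (inj₂ (refl , λ e → v1≢v3 (sym e)))
  t3≢t4 : typ v3 v2 ≢ typ v3 v4
  t3≢t4 = ad4 v3 v2 el3 (inj₁ (refl , λ e → v2≢v4 (sym e)))
  a2≡a3 : cls v1 v2 ≡ cls v3 v2
  a2≡a3 = sameB⇒sameClass el2 el3
  i2<i3 : typ v1 v2 < typ v3 v2
  i2<i3 = ≤∧≢⇒< (<H-sameClass⇒type≤ {h = F (χ v1 v2)} {F (χ v3 v2)}
                   (F-strictMono F validF (low el2) c2<c3 (high el3)) a2≡a3) t2≢t3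
  at-v1 : cls v1 v2 <lex cls v1 v0 × FirstDiff (cls v1 v2) (cls v1 v0) (typ v1 v2)
  at-v1 = sameA⇒classStep el2 el1 t2≢t1
            (<H⇒class≤ {h = F (χ v1 v2)} {F (χ v1 v0)} (F-strictMono F validF (low el2) c2<c1 (high el1)))
  at-v3 : cls v3 v2 <lex cls v3 v4 × FirstDiff (cls v3 v2) (cls v3 v4) (typ v3 v2)
  at-v3 = sameA⇒classStep el3 el4 t3≢t4
            (<H⇒class≤ {h = F (χ v3 v2)} {F (χ v3 v4)} (F-strictMono F validF (low el3) c3<c4 (high el4)))
  a4<a1 : cls v3 v4 <lex cls v1 v0
  a4<a1 = <lex-decidedEarlier (proj₂ at-v1) (proj₁ at-v1)
            (subst (λ c → FirstDiff c (cls v3 v4) (typ v3 v2)) (sym a2≡a3) (proj₂ at-v3)) i2<i3
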